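{- Let $G$ be a chordal ordered graph, let $v$ be the smallest vertex of $G$, let $r$ be a non-negative integer, let $C$ be the vertex set of a component of $G-N_r[v]$, and let $K$ be the set of vertices in $N_r[v]$ which have a neighbor in $C$. Then $K$ induces a clique in $G$, and all vertices in $K$ are smaller than all vertices in $C$.
   Context: An ordered graph is a finite graph with a linear ordering of its vertices. An ordered graph $G$ is chordal if for every vertex $v\in V(G)$, the neighbors of $v$ that are smaller than $v$ induce a clique in $G$. $N_r[v]$ denotes the set of vertices of $G$ at distance at most $r$ from $v$. -}

module Defs where

open import Level using (0ℓ)
open import Data.Nat using (ℕ; zero; suc)
import Data.Nat as ℕ
open import Data.Fin using (Fin; _<_; _≤_)
open import Data.Product using (Σ; ∃; _×_; _,_)
open import Relation.Nullary using (¬_)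
open import Relation.Binary.PropositionalEquality using (_≡_; _≢_)

-- A finite simple graph on vertex set Fin n.  The linear ordering of the
-- ordered graph is the natural ordering of Fin n.
record Graph (n : ℕ) : Set₁ where
  field
    Adj     : Fin n → Fin n → Set
    sym     : ∀ {x y} → Adj x y → Adj y x
    irrefl  : ∀ {x} → ¬ Adj x x

open Graph public

VSet : ℕ → Set₁
VSet n = Fin n → Set

data Walk {n : ℕ} (E : Fin n → Fin n → Set) : Fin n → Fin n → ℕ → Set where
  nil  : ∀ {x} → Walk E x x 0
  cons : ∀ {x y z k} → E x y → Walk E y z k → Walk E x z (suc k)

IsClique : ∀ {n} → Graph n → VSet n → Set
IsClique G S = ∀ x y → S x → S y → x ≢ y → Adj G x y

Chordal : ∀ {n} → Graph n → Set
Chordal G = ∀ v → IsClique G (λ u → u < v × Adj G u v)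

Ball : ∀ {n} → Graph n → Fin n → ℕ → VSet n
Ball G v r x = Σ ℕ λ k → k ℕ.≤ r × Walk (Adj G) v x k

InducedAdj : ∀ {n} → Graph n → VSet n → Fin n → Fin n → Set
InducedAdj G S x y = S x × S y × Adj G x y

-- C is the vertex set of a connected component of the induced subgraph G[S]
-- (i.e. of G minus the complement of S): nonempty, contained in S,
-- connected in G[S], and maximal (closed under G[S]-adjacency).
IsComponent : ∀ {n} → Graph n → VSet n → VSet n → Set
IsComponent G S C =
  (∃ λ x → C x) ×
  (∀ x → C x → S x) ×
  (∀ x y → C x → C y → ∃ λ k → Walk (InducedAdj G S) x y k) ×
  (∀ x y → C x → InducedAdj G S x y → C y)

-- Walks through a set P that end at a vertex b above their start can be
-- shortened until their last step rises: an internal local maximum s of a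
-- walk has its two neighbours equal or adjacent by chordality, so it can be
-- cut out.  Applied to a walk from v to x in N_r[v], this shows that every
-- smaller neighbour of x lies in N_r[v] as well.  Hence a vertex x of K
-- above some vertex of C would, via a walk through C, have a smaller
-- neighbour in C, which is absurd; and for x₁ < x₂ in K a walk
-- x₁ → C → x₂ (whose inner vertices all lie above x₂) must end with the
-- step x₁ x₂.
module Submission where

open import Defs
open import Data.Nat using (ℕ)
open import Data.Fin using (Fin; _<_; _≤_)
open import Data.Product using (Σ; ∃; _×_; _,_)
open import Relation.Nullary using (¬_)

open import Data.Nat using (suc; z≤n; s≤s)
import Data.Nat as ℕ
import Data.Nat.Properties as ℕ
open import Data.Nat.Induction using (<-wellFounded)
open import Data.Fin.Properties using (<-cmp; <-irrefl; <-asym; <-trans; _≟_)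
open import Data.Product using (proj₂)
open import Data.Sum using (_⊎_; inj₁; inj₂)
open import Data.Empty using (⊥-elim)
open import Level using (0ℓ)
open import Induction.WellFounded using (Acc; acc)
open import Relation.Nullary using (yes; no)
open import Relation.Binary using (Rel; tri<; tri≈; tri>)
open import Relation.Binary.PropositionalEquality using (_≡_; _≢_; refl)

module _ {n : ℕ} where

  From : VSet n → Rel (Fin n) 0ℓ → Rel (Fin n) 0ℓ
  From P E x y = P x × E x y

  Walk-map : ∀ {E E′ : Rel (Fin n) 0ℓ} → (∀ {x y} → E x y → E′ x y) →
             ∀ {a b k} → Walk E a b k → Walk E′ a b k
  Walk-map f nil        = nil
  Walk-map f (cons e w) = cons (f e) (Walk-map f w)

  _▷_ : ∀ {E : Rel (Fin n) 0ℓ} {a b c k} → Walk E a b k → E b c → Walk E a c (suc k)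
  nil      ▷ e′ = cons e′ nil
  cons e w ▷ e′ = cons e (w ▷ e′)

  Walk-within : ∀ {E : Rel (Fin n) 0ℓ} {P : VSet n} → (∀ {x y} → P x → E x y → P y) →
                ∀ {a b k} → P a → Walk E a b k → Walk (From P E) a b k
  Walk-within closed pa nil        = nil
  Walk-within closed pa (cons e w) = cons (pa , e) (Walk-within closed (closed pa e) w)

  ShortcutClosed : Rel (Fin n) 0ℓ → Set
  ShortcutClosed E = ∀ {a s s′} → a < s → s′ < s → a ≢ s′ → E a s → E s s′ → E a s′

  From-shortcutClosed : ∀ {E} {P : VSet n} → ShortcutClosed E → ShortcutClosed (From P E)
  From-shortcutClosed closed a<s s′<s a≢s′ (pa , e) (_ , e′) = pa , closed a<s s′<s a≢s′ e e′

  chordal⇒shortcutClosed : (G : Graph n) → Chordal G → ShortcutClosed (Adj G)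
  chordal⇒shortcutClosed G chordal {s = s} {s′} a<s s′<s a≢s′ e e′ =
    chordal s _ s′ (a<s , e) (s′<s , sym G e′) a≢s′

module Descent {n : ℕ} {E : Rel (Fin n) 0ℓ} (closed : ShortcutClosed E) where

  record EnteredFromBelow (a b : Fin n) (k : ℕ) : Set where
    constructor enteredFromBelow
    field
      {pred}   : Fin n
      {len}    : ℕ
      pred<b   : pred < b
      lastStep : E pred b
      len<k    : len ℕ.< k
      walk     : Walk E a pred len

  EnteredFromBelow-mono : ∀ {a b j k} → j ℕ.≤ k → EnteredFromBelow a b j → EnteredFromBelow a b k
  EnteredFromBelow-mono j≤k (enteredFromBelow y<b e i<j w) =
    enteredFromBelow y<b e (ℕ.<-≤-trans i<j j≤k) w

  data Shape (a s b : Fin n) (m : ℕ) : Set where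
    shortcut : ∀ {j} → j ℕ.≤ m → Walk E a b j → Shape a s b m
    rises    : EnteredFromBelow a b (suc m) → Shape a s b m
    falls    : b < a → s < a → Shape a s b m

  shape : ∀ {a s b m} → E a s → Walk E s b m → Shape a s b m
  shape {a} {s} e nil with <-cmp a s
  ... | tri< a<s _ _  = rises (enteredFromBelow a<s e (s≤s z≤n) nil)
  ... | tri≈ _ refl _ = shortcut z≤n nil
  ... | tri> _ _ s<a  = falls s<a s<a
  shape {a} {s} e (cons {y = s′} e′ w) with shape e′ w
  ... | shortcut j≤m w′ = shortcut (s≤s j≤m) (cons e w′)
  ... | rises (enteredFromBelow y<b ey i<m w′) =
    rises (enteredFromBelow y<b ey (s≤s i<m) (cons e w′))
  ... | falls b<s s′<s with <-cmp a s
  ...   | tri> _ _ s<a  = falls (<-trans b<s s<a) s<a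
  ...   | tri≈ _ refl _ = shortcut ℕ.≤-refl (cons e′ w)
  ...   | tri< a<s _ _ with a ≟ s′
  ...     | yes refl = shortcut (ℕ.n≤1+n _) w
  ...     | no a≢s′  = shortcut ℕ.≤-refl (cons (closed a<s s′<s a≢s′ e e′) w)

  enterFromBelow : ∀ {a b k} → a < b → Walk E a b k → EnteredFromBelow a b k
  enterFromBelow = go (<-wellFounded _)
    where
    go : ∀ {a b k} → Acc ℕ._<_ k → a < b → Walk E a b k → EnteredFromBelow a b k
    go _ a<b nil = ⊥-elim (<-irrefl refl a<b)
    go (acc rec) a<b (cons e w) with shape e w
    ... | shortcut j≤m w′ = EnteredFromBelow-mono (ℕ.m≤n⇒m≤1+n j≤m) (go (rec (s≤s j≤m)) a<b w′)
    ... | rises entered   = entered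
    ... | falls b<a _     = ⊥-elim (<-asym a<b b<a)

open Descent using (enteredFromBelow; enterFromBelow)

module _ {n : ℕ} (G : Graph n) (chordal : Chordal G) where

  Ball-lowerNeighbour : ∀ {v r x y} → v < x → Ball G v r x → y < x → Adj G y x → Ball G v r y
  Ball-lowerNeighbour {y = y} v<x (k , k≤r , w) y<x yx
    with enterFromBelow (chordal⇒shortcutClosed G chordal) v<x w
  ... | enteredFromBelow {u} {j} u<x ux j<k w′ with u ≟ y
  ...   | yes refl = j , ℕ.≤-trans (ℕ.<⇒≤ j<k) k≤r , w′
  ...   | no u≢y   = suc j , ℕ.≤-trans j<k k≤r , w′ ▷ chordal _ u y (u<x , ux) (y<x , yx) u≢y

  walkToAttachment : ∀ {S C c c′ x} → IsComponent G S C → C c → C c′ → Adj G x c′ →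
                     ∃ λ k → Walk (From C (Adj G)) c x k
  walkToAttachment (_ , _ , connected , closed) cc cc′ xc′ with connected _ _ cc cc′
  ... | k , w = suc k , Walk-map (λ { (cx , _ , _ , e) → cx , e })
                                 (Walk-within (λ {x} {y} → closed x y) cc w)
                        ▷ (cc′ , sym G xc′)

  attachment<component : ∀ {v r C x c′ c} → (∀ u → v ≤ u) →
                         IsComponent G (λ z → ¬ Ball G v r z) C →
                         Ball G v r x → C c′ → Adj G x c′ → C c → x < c
  attachment<component {x = x} {c = c} minimal component@(_ , outside , _) x∈B cc′ xc′ cc
    with <-cmp x c
  ... | tri< x<c _ _  = x<c
  ... | tri≈ _ refl _ = ⊥-elim (outside c cc x∈B)
  ... | tri> _ _ c<x
    with enterFromBelow (From-shortcutClosed (chordal⇒shortcutClosed G chordal)) c<x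
                        (proj₂ (walkToAttachment component cc cc′ xc′))
  ... | enteredFromBelow {y} y<x (cy , yx) _ _ = ⊥-elim (
    outside y cy (Ball-lowerNeighbour (ℕ.≤-<-trans (minimal c) c<x) x∈B y<x yx))

  attachments-adjacent : ∀ {S C x₁ x₂ c₁ c₂} → IsComponent G S C →
                         C c₁ → Adj G x₁ c₁ → C c₂ → Adj G x₂ c₂ →
                         (∀ c → C c → x₂ < c) → x₁ < x₂ → Adj G x₁ x₂
  attachments-adjacent {C = C} {x₁} {x₂} component cc₁ x₁c₁ cc₂ x₂c₂ x₂<C x₁<x₂
    with enterFromBelow (From-shortcutClosed (chordal⇒shortcutClosed G chordal)) x₁<x₂ walk
    where
    walk : Walk (From (λ z → z ≡ x₁ ⊎ x₂ < z) (Adj G)) x₁ x₂ _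
    walk = cons (inj₁ refl , x₁c₁)
                (Walk-map (λ { (cz , e) → inj₂ (x₂<C _ cz) , e })
                          (proj₂ (walkToAttachment component cc₁ cc₂ x₂c₂)))
  ... | enteredFromBelow _ (inj₁ refl , x₁x₂) _ _    = x₁x₂
  ... | enteredFromBelow y<x₂ (inj₂ x₂<y , _) _ _ = ⊥-elim (<-asym x₂<y y<x₂)

IsClique-fromOrdered : ∀ {n} (G : Graph n) {S : VSet n} →
                       (∀ {x y} → S x → S y → x < y → Adj G x y) → IsClique G S
IsClique-fromOrdered G ordered x y sx sy x≢y with <-cmp x y
... | tri< x<y _ _ = ordered sx sy x<y
... | tri≈ _ x≡y _ = ⊥-elim (x≢y x≡y)
... | tri> _ _ y<x = sym G (ordered sy sx y<x)

lemma8 : ∀ {n} (G : Graph n) → Chordal G →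
         (v : Fin n) → (∀ (u : Fin n) → v ≤ u) →
         (r : ℕ) →
         (C : VSet n) → IsComponent G (λ x → ¬ Ball G v r x) C →
         let K : VSet n
             K = λ x → Ball G v r x × ∃ (λ c → C c × Adj G x c)
         in IsClique G K × (∀ x c → K x → C c → x < c)
lemma8 {n} G chordal v minimal r C component = clique , below
  where
  K : VSet n
  K x = Ball G v r x × ∃ (λ c → C c × Adj G x c)

  below : ∀ x c → K x → C c → x < c
  below x c (x∈B , c′ , cc′ , xc′) =
    attachment<component G chordal minimal component x∈B cc′ xc′

  clique : IsClique G K
  clique = IsClique-fromOrdered G λ { (_ , _ , cc₁ , x₁c₁) k₂@(_ , _ , cc₂ , x₂c₂) →
    attachments-adjacent G chordal component cc₁ x₁c₁ cc₂ x₂c₂ (λ c → below _ c k₂) }
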